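{- Let $H$ be a multigraph (loops allowed, no multiple edges) such that $|N_H(h)\cap N_H(h')|\le 1$ for all distinct $h,h'\in V(H)$. Let $I=(G,L)$ be a reduced list $H$-colouring instance, and let $v\in V(G)$ have degree $d(v)$. For $h\in V(H)$ let $C_h=\{v'\in N_G(v): L_{v'}\subseteq N_H(h)\}$. Then there is at most one $h\in L_v$ for which $|C_h|>\frac12 d(v)$.
   Context: $G$ is a finite simple graph. For a multigraph $H$, $N_H(h)=\{h':hh'\in E(H)\}$ (containing $h$ iff there is a loop at $h$). A list $H$-colouring instance $(G,L)$ assigns to each $v\in V(G)$ a list $L_v\subseteq V(H)$. The instance is reduced if $|L_v|\ge 2$ for all $v\in V(G)$. -}

module Defs where

open import Data.Nat using (ℕ; _≤_; _<_; _*_)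
open import Data.Bool using (Bool; true; false; _∧_)
open import Data.Fin using (Fin)
open import Data.Fin.Subset using (Subset; _⊆_; _∩_; ∣_∣; _∈_)
open import Data.Fin.Subset.Properties using (_⊆?_)
open import Data.Vec using (tabulate)
open import Relation.Nullary using (¬_; does)
open import Relation.Binary.PropositionalEquality using (_≡_)

record SimpleGraph (n : ℕ) : Set where
  field
    adj   : Fin n → Fin n → Bool
    sym   : ∀ u w → adj u w ≡ adj w u
    irref : ∀ u → adj u u ≡ false

-- A multigraph without multiple edges, loops allowed, on vertex set Fin m:
-- a symmetric adjacency relation (adj h h ≡ true means a loop at h).
record LoopGraph (m : ℕ) : Set where
  field
    adj : Fin m → Fin m → Bool
    sym : ∀ h h' → adj h h' ≡ adj h' h

NG : ∀ {n} → SimpleGraph n → Fin n → Subset n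
NG G v = tabulate (SimpleGraph.adj G v)

NH : ∀ {m} → LoopGraph m → Fin m → Subset m
NH H h = tabulate (LoopGraph.adj H h)

degree : ∀ {n} → SimpleGraph n → Fin n → ℕ
degree G v = ∣ NG G v ∣

ListAssignment : ℕ → ℕ → Set
ListAssignment n m = Fin n → Subset m

Reduced : ∀ {n m} → ListAssignment n m → Set
Reduced L = ∀ v → 2 ≤ ∣ L v ∣

C : ∀ {n m} → SimpleGraph n → LoopGraph m → ListAssignment n m →
    Fin n → Fin m → Subset n
C G H L v h = tabulate (λ v' → SimpleGraph.adj G v v' ∧ does (L v' ⊆? NH H h))

module Submission where

-- Suppose h ≢ h' both satisfy |C_h| > d(v)/2.  The sets C_h and C_h'
-- are disjoint: a common vertex v' would have L_{v'} ⊆ N_H(h) ∩ N_H(h'),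
-- a set of size at most 1 by the codegree hypothesis, whereas the instance
-- is reduced, so |L_{v'}| ≥ 2.  Both sets lie inside N_G(v), hence
-- |C_h| + |C_h'| ≤ d(v), contradicting |C_h|, |C_h'| > d(v)/2.

open import Defs
open import Data.Nat using (_≤_; _<_; _*_; _+_; suc)
open import Data.Nat.Properties
  using (+-suc; +-identityʳ; +-mono-≤; +-mono-<; *-distribˡ-+; *-monoʳ-≤;
         ≤-trans; <-≤-trans; <-irrefl; ≤-refl; module ≤-Reasoning)
open import Data.Fin using (Fin; _≟_)
open import Data.Fin.Subset
  using (Subset; _∈_; _∩_; _∪_; ∣_∣; _⊆_; inside; outside; Empty)
open import Data.Fin.Subset.Properties
  using (p⊆q⇒∣p∣≤∣q∣; x∈p∩q⁺; x∈p∩q⁻; x∈p∪q⁻; Empty-unique; ∣⊥∣≡0; _⊆?_)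
open import Data.Vec using ([]; _∷_; tabulate)
open import Data.Vec.Properties using ([]=⇒lookup; lookup⇒[]=; lookup∘tabulate)
open import Data.Bool using (Bool; true; _∧_)
open import Data.Product using (_×_; _,_; proj₁; proj₂)
open import Data.Sum using ([_,_])
open import Data.Empty using (⊥-elim)
open import Relation.Nullary using (¬_; does; yes; no)
open import Relation.Binary.PropositionalEquality
  using (_≡_; refl; sym; trans; cong)

∣p∣+∣q∣≡∣p∪q∣+∣p∩q∣ : ∀ {n} (p q : Subset n) → ∣ p ∣ + ∣ q ∣ ≡ ∣ p ∪ q ∣ + ∣ p ∩ q ∣
∣p∣+∣q∣≡∣p∪q∣+∣p∩q∣ []            []            = refl
∣p∣+∣q∣≡∣p∪q∣+∣p∩q∣ (outside ∷ p) (outside ∷ q) = ∣p∣+∣q∣≡∣p∪q∣+∣p∩q∣ p q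
∣p∣+∣q∣≡∣p∪q∣+∣p∩q∣ (inside  ∷ p) (outside ∷ q) = cong suc (∣p∣+∣q∣≡∣p∪q∣+∣p∩q∣ p q)
∣p∣+∣q∣≡∣p∪q∣+∣p∩q∣ (outside ∷ p) (inside  ∷ q) =
  trans (+-suc ∣ p ∣ ∣ q ∣) (cong suc (∣p∣+∣q∣≡∣p∪q∣+∣p∩q∣ p q))
∣p∣+∣q∣≡∣p∪q∣+∣p∩q∣ (inside  ∷ p) (inside  ∷ q) =
  cong suc (trans (+-suc ∣ p ∣ ∣ q ∣)
    (trans (cong suc (∣p∣+∣q∣≡∣p∪q∣+∣p∩q∣ p q)) (sym (+-suc ∣ p ∪ q ∣ ∣ p ∩ q ∣))))

∪-least : ∀ {n} {p q s : Subset n} → p ⊆ s → q ⊆ s → p ∪ q ⊆ s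
∪-least {p = p} {q} p⊆s q⊆s x∈p∪q = [ p⊆s , q⊆s ] (x∈p∪q⁻ p q x∈p∪q)

disjoint-⊆⇒∣p∣+∣q∣≤∣s∣ : ∀ {n} {p q s : Subset n} →
  p ⊆ s → q ⊆ s → Empty (p ∩ q) → ∣ p ∣ + ∣ q ∣ ≤ ∣ s ∣
disjoint-⊆⇒∣p∣+∣q∣≤∣s∣ {n} {p} {q} {s} p⊆s q⊆s p∩q-empty = begin
  ∣ p ∣ + ∣ q ∣         ≡⟨ ∣p∣+∣q∣≡∣p∪q∣+∣p∩q∣ p q ⟩
  ∣ p ∪ q ∣ + ∣ p ∩ q ∣ ≡⟨ cong (∣ p ∪ q ∣ +_) ∣p∩q∣≡0 ⟩
  ∣ p ∪ q ∣ + 0         ≤⟨ +-mono-≤ (p⊆q⇒∣p∣≤∣q∣ (∪-least p⊆s q⊆s)) ≤-refl ⟩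
  ∣ s ∣ + 0             ≡⟨ +-identityʳ ∣ s ∣ ⟩
  ∣ s ∣                 ∎
  where
  open ≤-Reasoning
  ∣p∩q∣≡0 : ∣ p ∩ q ∣ ≡ 0
  ∣p∩q∣≡0 = trans (cong ∣_∣ (Empty-unique p∩q-empty)) (∣⊥∣≡0 n)

∈-tabulate⁻ : ∀ {n} (f : Fin n → Bool) {x : Fin n} → x ∈ tabulate f → f x ≡ true
∈-tabulate⁻ f {x} x∈ = trans (sym (lookup∘tabulate f x)) ([]=⇒lookup x∈)

∈-tabulate⁺ : ∀ {n} (f : Fin n → Bool) {x : Fin n} → f x ≡ true → x ∈ tabulate f
∈-tabulate⁺ f {x} fx≡true = lookup⇒[]= x _ (trans (lookup∘tabulate f x) fx≡true)

∧≡true⁻ : ∀ {a b : Bool} → a ∧ b ≡ true → a ≡ true × b ≡ true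
∧≡true⁻ {true} b≡true = refl , b≡true

module _ {n m} (G : SimpleGraph n) (H : LoopGraph m) (L : ListAssignment n m)
         (v : Fin n) where

  C⊆NG : ∀ h → C G H L v h ⊆ NG G v
  C⊆NG h x∈C =
    ∈-tabulate⁺ (SimpleGraph.adj G v) (proj₁ (∧≡true⁻ (∈-tabulate⁻ _ x∈C)))

  ∈C⇒L⊆NH : ∀ h {x} → x ∈ C G H L v h → L x ⊆ NH H h
  -- Abstracting the decision together with the fact that it returned true
  -- makes the 'no' case absurd (its second component becomes false ≡ true).
  ∈C⇒L⊆NH h {x} x∈C
    with L x ⊆? NH H h | proj₂ (∧≡true⁻ {SimpleGraph.adj G v x} (∈-tabulate⁻ _ x∈C))
  ... | yes Lx⊆NHh | _ = Lx⊆NHh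

  -- In a reduced instance, if distinct vertices of H have at most one common
  -- neighbour, then C_h and C_h' are disjoint: a common vertex x would have
  -- its list of size ≥ 2 inside N_H(h) ∩ N_H(h').
  C-disjoint : (∀ h h' → ¬ h ≡ h' → ∣ NH H h ∩ NH H h' ∣ ≤ 1) → Reduced L →
               ∀ {h h'} → ¬ h ≡ h' → Empty (C G H L v h ∩ C G H L v h')
  C-disjoint codegree reduced {h} {h'} h≢h' (x , x∈C∩C') =
    <-irrefl refl (≤-trans (reduced x) ∣Lx∣≤1)
    where
    Lx⊆NH∩NH : L x ⊆ NH H h ∩ NH H h'
    Lx⊆NH∩NH y∈Lx with x∈p∩q⁻ _ _ x∈C∩C'
    ... | x∈C , x∈C' = x∈p∩q⁺ (∈C⇒L⊆NH h x∈C y∈Lx , ∈C⇒L⊆NH h' x∈C' y∈Lx)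

    ∣Lx∣≤1 : ∣ L x ∣ ≤ 1
    ∣Lx∣≤1 = ≤-trans (p⊆q⇒∣p∣≤∣q∣ Lx⊆NH∩NH) (codegree h h' h≢h')

halves-exceed : ∀ d a b → d < 2 * a → d < 2 * b → ¬ (a + b ≤ d)
halves-exceed d a b d<2a d<2b a+b≤d = <-irrefl refl (begin-strict
  d + d           <⟨ +-mono-< d<2a d<2b ⟩
  2 * a + 2 * b   ≡⟨ sym (*-distribˡ-+ 2 a b) ⟩
  2 * (a + b)     ≤⟨ *-monoʳ-≤ 2 a+b≤d ⟩
  2 * d           ≡⟨ cong (d +_) (+-identityʳ d) ⟩
  d + d           ∎)
  where open ≤-Reasoning

lemma2 : ∀ {n m} (G : SimpleGraph n) (H : LoopGraph m) (L : ListAssignment n m) →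
         (∀ h h' → ¬ h ≡ h' → ∣ NH H h ∩ NH H h' ∣ ≤ 1) →
         Reduced L →
         (v : Fin n) (h h' : Fin m) →
         h ∈ L v → h' ∈ L v →
         degree G v < 2 * ∣ C G H L v h ∣ →
         degree G v < 2 * ∣ C G H L v h' ∣ →
         h ≡ h'
lemma2 G H L codegree reduced v h h' _ _ big big' with h ≟ h'
... | yes h≡h' = h≡h'
... | no h≢h'  =
  ⊥-elim (halves-exceed (degree G v) ∣ C G H L v h ∣ ∣ C G H L v h' ∣ big big'
           (disjoint-⊆⇒∣p∣+∣q∣≤∣s∣ (C⊆NG G H L v h) (C⊆NG G H L v h')
              (C-disjoint G H L v codegree reduced h≢h')))
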